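{- (a) Let $S_1,S_2,S_3$ be NAA. Then $[\![S_1\vee S_2]\!]=[\![S_1]\!]\cup[\![S_2]\!]$, and $S_1\vee S_2\le_m S_3$ iff $S_1\le_m S_3$ and $S_2\le_m S_3$. (b) The same two statements hold when $S_1,S_2,S_3$ are DMTS.
   Context: Fix a finite alphabet $\Sigma$. NAA: $(S,S^0,\mathrm{Tran})$ with $S^0\subseteq S$ finite, $\mathrm{Tran}:S\to 2^{\mathcal P_{\mathrm{fin}}(\Sigma\times S)}$; NAA modal refinement $R$: for $(s_1,s_2)\in R$ and $M_1\in\mathrm{Tran}_1(s_1)$ there exists $M_2\in\mathrm{Tran}_2(s_2)$ with every $(a,t_1)\in M_1$ matched by some $(a,t_2)\in M_2$ with $(t_1,t_2)\in R$ and vice versa. DMTS: $(S,S^0,\dashrightarrow,\longrightarrow)$ with $S^0$ finite, image-finite may relation $\dashrightarrow\subseteq S\times\Sigma\times S$, must relation $\longrightarrow\subseteq S\times 2^{\Sigma\times S}$ with $s\longrightarrow N$, $(a,t)\in N$ implying $s\overset a\dashrightarrow t$; DMTS modal refinement $R$: for $(s_1,s_2)\in R$, every $s_1\overset a\dashrightarrow t_1$ is matched by $s_2\overset a\dashrightarrow t_2$ with $(t_1,t_2)\in R$ and every $s_2\longrightarrow N_2$ by some $s_1\longrightarrow N_1$ with each $(a,t_1)\in N_1$ having $(a,t_2)\in N_2$, $(t_1,t_2)\in R$. A refinement is initialised if each initial state on the left is related to some initial state on the right; $S_1\le_m S_2$ iff one exists. An LTS $(I,i^0,\to)$ (image-finite)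 is the NAA with initial set $\{i^0\}$ and $\mathrm{Tran}(s)=\{\{(a,t)\mid s\xrightarrow at\}\}$, resp. the DMTS with may $=\to$ and must $=\{(s,\{(a,t)\})\mid s\xrightarrow a t\}$; $[\![S]\!]$ is the set of LTS $I$ with $I\le_m S$. Disjunction (state sets assumed disjoint): for NAA, $S_1\vee S_2=(S_1\cup S_2,S_1^0\cup S_2^0,\mathrm{Tran}_1\cup\mathrm{Tran}_2)$; for DMTS, $S_1\vee S_2=(S_1\cup S_2,S_1^0\cup S_2^0,\dashrightarrow_1\cup\dashrightarrow_2,\longrightarrow_1\cup\longrightarrow_2)$. -}

module Defs where

open import Data.List using (List; map; _++_; [_])
open import Data.List.Membership.Propositional using (_∈_)
open import Data.List.Membership.Propositional.Properties using (∈-map⁺; ∈-map⁻)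
open import Data.Product using (Σ; ∃; ∃-syntax; _×_; _,_; proj₁; proj₂)
open import Data.Sum using (_⊎_; inj₁; inj₂)
open import Relation.Binary.PropositionalEquality using (_≡_; refl; subst)
import Data.List.Relation.Unary.Any

-- Alphabet: an arbitrary type A (the theorem instantiates A = Fin k).
-- Finite subsets of (A × S) are represented by lists (only membership is used).

record LTS (A : Set) : Set₁ where
  field
    State : Set
    init  : State
    succ  : State → List (A × State)

record NAA (A : Set) : Set₁ where
  field
    State : Set
    Init  : List State
    Tran  : State → List (A × State) → Set

relabel : {A S T : Set} → (S → T) → List (A × S) → List (A × T)
relabel f = map (λ p → proj₁ p , f (proj₂ p))

module _ {A : Set} where

  IsNAARefinement : (S₁ S₂ : NAA A) → (NAA.State S₁ → NAA.State S₂ → Set) → Set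
  IsNAARefinement S₁ S₂ R =
    ∀ {s₁ s₂} → R s₁ s₂ → ∀ {M₁} → NAA.Tran S₁ s₁ M₁ →
      ∃[ M₂ ] ( NAA.Tran S₂ s₂ M₂
              × (∀ {a t₁} → (a , t₁) ∈ M₁ → ∃[ t₂ ] ((a , t₂) ∈ M₂ × R t₁ t₂))
              × (∀ {a t₂} → (a , t₂) ∈ M₂ → ∃[ t₁ ] ((a , t₁) ∈ M₁ × R t₁ t₂)))

  NAAInitialised : (S₁ S₂ : NAA A) → (NAA.State S₁ → NAA.State S₂ → Set) → Set
  NAAInitialised S₁ S₂ R =
    ∀ {s₁} → s₁ ∈ NAA.Init S₁ → ∃[ s₂ ] (s₂ ∈ NAA.Init S₂ × R s₁ s₂)

  _≤NAA_ : NAA A → NAA A → Set₁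
  S₁ ≤NAA S₂ = ∃[ R ] (IsNAARefinement S₁ S₂ R × NAAInitialised S₁ S₂ R)

  LTS→NAA : LTS A → NAA A
  LTS→NAA I = record
    { State = LTS.State I
    ; Init  = [ LTS.init I ]
    ; Tran  = λ s M → M ≡ LTS.succ I s
    }

  ⟦_⟧NAA : NAA A → LTS A → Set₁
  ⟦ S ⟧NAA I = LTS→NAA I ≤NAA S

  _∨NAA_ : NAA A → NAA A → NAA A
  S₁ ∨NAA S₂ = record
    { State = NAA.State S₁ ⊎ NAA.State S₂
    ; Init  = map inj₁ (NAA.Init S₁) ++ map inj₂ (NAA.Init S₂)
    ; Tran  = λ { (inj₁ s) M → ∃[ M₁ ] (NAA.Tran S₁ s M₁ × M ≡ relabel inj₁ M₁)
                ; (inj₂ s) M → ∃[ M₂ ] (NAA.Tran S₂ s M₂ × M ≡ relabel inj₂ M₂) }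
    }

record DMTS (A : Set) : Set₁ where
  field
    State  : Set
    Init   : List State
    may    : State → List (A × State)
    Must   : State → List (A × State) → Set
    must⊆may : ∀ {s N} → Must s N → ∀ {x} → x ∈ N → x ∈ may s

module _ {A : Set} where

  IsDMTSRefinement : (S₁ S₂ : DMTS A) → (DMTS.State S₁ → DMTS.State S₂ → Set) → Set
  IsDMTSRefinement S₁ S₂ R =
    ∀ {s₁ s₂} → R s₁ s₂ →
      (∀ {a t₁} → (a , t₁) ∈ DMTS.may S₁ s₁ →
         ∃[ t₂ ] ((a , t₂) ∈ DMTS.may S₂ s₂ × R t₁ t₂))
    × (∀ {N₂} → DMTS.Must S₂ s₂ N₂ →
         ∃[ N₁ ] ( DMTS.Must S₁ s₁ N₁
                 × (∀ {a t₁} → (a , t₁) ∈ N₁ → ∃[ t₂ ] ((a , t₂) ∈ N₂ × R t₁ t₂))))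

  DMTSInitialised : (S₁ S₂ : DMTS A) → (DMTS.State S₁ → DMTS.State S₂ → Set) → Set
  DMTSInitialised S₁ S₂ R =
    ∀ {s₁} → s₁ ∈ DMTS.Init S₁ → ∃[ s₂ ] (s₂ ∈ DMTS.Init S₂ × R s₁ s₂)

  _≤DMTS_ : DMTS A → DMTS A → Set₁
  S₁ ≤DMTS S₂ = ∃[ R ] (IsDMTSRefinement S₁ S₂ R × DMTSInitialised S₁ S₂ R)

  LTS→DMTS : LTS A → DMTS A
  LTS→DMTS I = record
    { State = LTS.State I
    ; Init  = [ LTS.init I ]
    ; may   = LTS.succ I
    ; Must  = λ s N → ∃[ x ] (x ∈ LTS.succ I s × N ≡ [ x ])
    ; must⊆may = λ { (x , x∈ , refl) (Data.List.Relation.Unary.Any.here refl) → x∈ }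
    }

  ⟦_⟧DMTS : DMTS A → LTS A → Set₁
  ⟦ S ⟧DMTS I = LTS→DMTS I ≤DMTS S

  private
    relabel-⊆ : {S T : Set} (f : S → T) {L L' : List (A × S)} →
                (∀ {x} → x ∈ L → x ∈ L') →
                ∀ {y} → y ∈ relabel f L → y ∈ relabel f L'
    relabel-⊆ f sub y∈ with ∈-map⁻ _ y∈
    ... | x , x∈ , refl = ∈-map⁺ _ (sub x∈)

  _∨DMTS_ : DMTS A → DMTS A → DMTS A
  S₁ ∨DMTS S₂ = record
    { State = DMTS.State S₁ ⊎ DMTS.State S₂
    ; Init  = map inj₁ (DMTS.Init S₁) ++ map inj₂ (DMTS.Init S₂)
    ; may   = λ { (inj₁ s) → relabel inj₁ (DMTS.may S₁ s)
                ; (inj₂ s) → relabel inj₂ (DMTS.may S₂ s) }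
    ; Must  = Must
    ; must⊆may = sub
    }
    where
    Must : DMTS.State S₁ ⊎ DMTS.State S₂ → List (A × (DMTS.State S₁ ⊎ DMTS.State S₂)) → Set
    Must (inj₁ s) N = ∃[ N₁ ] (DMTS.Must S₁ s N₁ × N ≡ relabel inj₁ N₁)
    Must (inj₂ s) N = ∃[ N₂ ] (DMTS.Must S₂ s N₂ × N ≡ relabel inj₂ N₂)
    sub : ∀ {s N} → Must s N → ∀ {x} → x ∈ N → x ∈ _
    sub {inj₁ s} (N₁ , m , refl) = relabel-⊆ inj₁ (DMTS.must⊆may S₁ m)
    sub {inj₂ s} (N₂ , m , refl) = relabel-⊆ inj₂ (DMTS.must⊆may S₂ m)

-- Each summand Sᵢ embeds into S₁ ∨ S₂ along injᵢ: the transitions of injᵢ s are exactly those of s,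
-- relabelled. Refinement relations can be restricted along such an embedding on either side, and
-- pushed forward along it on the right. For S₁ ∨ S₂ ≤ S₃ one restricts to each summand; conversely
-- the copairing of refinements of S₁ and S₂ refines S₁ ∨ S₂, since every state of the disjunction
-- lies in the image of one of the two embeddings. For the semantics, an implementation has a single
-- initial state, which is related to an initial state of one summand; one restricts to that summand.
module Submission where

open import Defs
open import Level using (Level)
open import Data.Nat using (ℕ)
open import Data.Fin using (Fin)
open import Data.List using (List; map; _++_)
open import Data.List.Membership.Propositional using (_∈_)
open import Data.List.Membership.Propositional.Properties
  using (∈-map⁺; ∈-map⁻; ∈-++⁻; ∈-++⁺ˡ; ∈-++⁺ʳ)
open import Data.List.Relation.Unary.Any using (here)
open import Data.Product using (_×_; ∃-syntax; _,_; proj₁; proj₂; map₁; map₂)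
open import Data.Sum using (_⊎_; inj₁; inj₂; [_,_]′)
open import Function.Bundles using (_⇔_; mk⇔)
open import Relation.Binary.PropositionalEquality using (_≡_; refl; sym; subst)

private
  variable
    ℓ : Level
    A X Y : Set

∈-map-inj-++-elim : {xs : List X} {ys : List Y} (P : X ⊎ Y → Set ℓ) →
                    (∀ {x} → x ∈ xs → P (inj₁ x)) → (∀ {y} → y ∈ ys → P (inj₂ y)) →
                    ∀ {z} → z ∈ map inj₁ xs ++ map inj₂ ys → P z
∈-map-inj-++-elim {xs = xs} P on₁ on₂ z∈ with ∈-++⁻ (map inj₁ xs) z∈
... | inj₁ z∈₁ with ∈-map⁻ inj₁ z∈₁
...   | x , x∈ , refl = on₁ x∈
∈-map-inj-++-elim P on₁ on₂ z∈ | inj₂ z∈₂ with ∈-map⁻ inj₂ z∈₂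
...   | y , y∈ , refl = on₂ y∈

module _ {f : X → Y} {L : List (A × X)} {a : A} where

  ∈-relabel⁺ : ∀ {x} → (a , x) ∈ L → (a , f x) ∈ relabel f L
  ∈-relabel⁺ = ∈-map⁺ _

  ∀-∈-relabel : {P : A → Y → Set} → (∀ {b x} → (b , x) ∈ L → P b (f x)) →
                ∀ {y} → (a , y) ∈ relabel f L → P a y
  ∀-∈-relabel h y∈ with ∈-map⁻ _ y∈
  ... | _ , x∈ , refl = h x∈

  ∃-∈-relabel⁺ : {P : Y → Set} →
                 ∃[ x ] ((a , x) ∈ L × P (f x)) → ∃[ y ] ((a , y) ∈ relabel f L × P y)
  ∃-∈-relabel⁺ (x , x∈ , p) = f x , ∈-relabel⁺ x∈ , p

  ∃-∈-relabel⁻ : {P : Y → Set} →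
                 ∃[ y ] ((a , y) ∈ relabel f L × P y) → ∃[ x ] ((a , x) ∈ L × P (f x))
  ∃-∈-relabel⁻ (y , y∈ , p) with ∈-map⁻ _ y∈
  ... | (_ , x) , x∈ , refl = x , x∈ , p

module _ {A : Set} where

  NAARefinesAt : (S₁ S₂ : NAA A) → (NAA.State S₁ → NAA.State S₂ → Set) →
                 NAA.State S₁ → NAA.State S₂ → Set
  NAARefinesAt S₁ S₂ R s₁ s₂ =
    ∀ {M₁} → NAA.Tran S₁ s₁ M₁ →
      ∃[ M₂ ] ( NAA.Tran S₂ s₂ M₂
              × (∀ {a t₁} → (a , t₁) ∈ M₁ → ∃[ t₂ ] ((a , t₂) ∈ M₂ × R t₁ t₂))
              × (∀ {a t₂} → (a , t₂) ∈ M₂ → ∃[ t₁ ] ((a , t₁) ∈ M₁ × R t₁ t₂)))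

  record IsNAAEmbedding (S T : NAA A) (e : NAA.State S → NAA.State T) : Set where
    field
      tran⁺ : ∀ {s M} → NAA.Tran S s M → NAA.Tran T (e s) (relabel e M)
      tran⁻ : ∀ {s M} → NAA.Tran T (e s) M → ∃[ M' ] (NAA.Tran S s M' × M ≡ relabel e M')
      init⁺ : ∀ {s} → s ∈ NAA.Init S → e s ∈ NAA.Init T

  module NAAEmbedding {S T : NAA A} {e : NAA.State S → NAA.State T}
                      (emb : IsNAAEmbedding S T e) where
    open IsNAAEmbedding emb

    refinement-∘ˡ : ∀ {U R} → IsNAARefinement T U R → IsNAARefinement S U (λ s → R (e s))
    refinement-∘ˡ ref r tr with ref r (tran⁺ tr)
    ... | M₃ , tr₃ , fwd , bwd =
      M₃ , tr₃ , (λ x∈ → fwd (∈-relabel⁺ x∈)) , (λ y∈ → ∃-∈-relabel⁻ (bwd y∈))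

    refinesAt-image : ∀ {U R} → IsNAARefinement S U (λ s → R (e s)) →
                      ∀ {s u} → R (e s) u → NAARefinesAt T U R (e s) u
    refinesAt-image ref r tr with tran⁻ tr
    ... | M , trS , refl with ref r trS
    ...   | M₃ , tr₃ , fwd , bwd = M₃ , tr₃ , ∀-∈-relabel fwd , (λ y∈ → ∃-∈-relabel⁺ (bwd y∈))

    refinement-∘ʳ : ∀ {X R} → IsNAARefinement X T R → IsNAARefinement X S (λ x s → R x (e s))
    refinement-∘ʳ ref r tr with ref r tr
    ... | _ , trT , fwd , bwd with tran⁻ trT
    ...   | M , trS , refl = M , trS , (λ x∈ → ∃-∈-relabel⁻ (fwd x∈)) , (λ y∈ → bwd (∈-relabel⁺ y∈))

    refinement-image : ∀ {X R} → IsNAARefinement X S R →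
                       IsNAARefinement X T (λ x t → ∃[ s ] (e s ≡ t × R x s))
    refinement-image {R = R} ref (s , refl , r) {M₁} tr with ref r tr
    ... | M , trS , fwd , bwd =
      relabel e M , tran⁺ trS ,
      (λ x∈ → ∃-∈-relabel⁺ (map₂ (map₂ λ r' → _ , refl , r') (fwd x∈))) ,
      ∀-∈-relabel {P = λ a t → ∃[ t₁ ] ((a , t₁) ∈ M₁ × ∃[ s ] (e s ≡ t × R t₁ s))}
                  (λ y∈ → map₂ (map₂ λ r' → _ , refl , r') (bwd y∈))

    ≤-∘ˡ : ∀ {U} → T ≤NAA U → S ≤NAA U
    ≤-∘ˡ {U} (R , ref , ini) = (λ s → R (e s)) , refinement-∘ˡ {U} ref , λ s∈ → ini (init⁺ s∈)

    ≤-image : ∀ {X} → X ≤NAA S → X ≤NAA T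
    ≤-image {X} (R , ref , ini) = (λ x t → ∃[ s ] (e s ≡ t × R x s)) , refinement-image {X} ref ,
      λ x∈ → let (s , s∈ , r) = ini x∈ in e s , init⁺ s∈ , s , refl , r

  module _ {S₁ S₂ : NAA A} where

    ∨NAA-inj₁ : IsNAAEmbedding S₁ (S₁ ∨NAA S₂) inj₁
    ∨NAA-inj₁ = record
      { tran⁺ = λ tr → _ , tr , refl
      ; tran⁻ = λ tr → tr
      ; init⁺ = λ s∈ → ∈-++⁺ˡ (∈-map⁺ inj₁ s∈)
      }

    ∨NAA-inj₂ : IsNAAEmbedding S₂ (S₁ ∨NAA S₂) inj₂
    ∨NAA-inj₂ = record
      { tran⁺ = λ tr → _ , tr , refl
      ; tran⁻ = λ tr → tr
      ; init⁺ = λ s∈ → ∈-++⁺ʳ (map inj₁ (NAA.Init S₁)) (∈-map⁺ inj₂ s∈)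
      }

    ∨NAA-refinement : ∀ {U R₁ R₂} → IsNAARefinement S₁ U R₁ → IsNAARefinement S₂ U R₂ →
                      IsNAARefinement (S₁ ∨NAA S₂) U [ R₁ , R₂ ]′
    ∨NAA-refinement {U} {R₁} {R₂} ref₁ ref₂ {inj₁ s} =
      NAAEmbedding.refinesAt-image ∨NAA-inj₁ {U} {[ R₁ , R₂ ]′} ref₁
    ∨NAA-refinement {U} {R₁} {R₂} ref₁ ref₂ {inj₂ s} =
      NAAEmbedding.refinesAt-image ∨NAA-inj₂ {U} {[ R₁ , R₂ ]′} ref₂

    ∨NAA-lub : ∀ S₃ → (S₁ ∨NAA S₂) ≤NAA S₃ ⇔ (S₁ ≤NAA S₃ × S₂ ≤NAA S₃)
    ∨NAA-lub S₃ = mk⇔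
      (λ le → NAAEmbedding.≤-∘ˡ ∨NAA-inj₁ {S₃} le , NAAEmbedding.≤-∘ˡ ∨NAA-inj₂ {S₃} le)
      (λ ((R₁ , ref₁ , ini₁) , (R₂ , ref₂ , ini₂)) →
        [ R₁ , R₂ ]′ , ∨NAA-refinement {S₃} ref₁ ref₂ ,
        ∈-map-inj-++-elim (λ s → ∃[ s₃ ] (s₃ ∈ NAA.Init S₃ × [ R₁ , R₂ ]′ s s₃)) ini₁ ini₂)

    ∨NAA-denotation : ∀ I → ⟦ S₁ ∨NAA S₂ ⟧NAA I ⇔ (⟦ S₁ ⟧NAA I ⊎ ⟦ S₂ ⟧NAA I)
    ∨NAA-denotation I =
      mk⇔ to [ NAAEmbedding.≤-image ∨NAA-inj₁ {LTS→NAA I}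
             , NAAEmbedding.≤-image ∨NAA-inj₂ {LTS→NAA I} ]′
      where
      to : ⟦ S₁ ∨NAA S₂ ⟧NAA I → ⟦ S₁ ⟧NAA I ⊎ ⟦ S₂ ⟧NAA I
      to (R , ref , ini) with ini (here refl)
      ... | x , x∈ , r =
        ∈-map-inj-++-elim (λ y → R (LTS.init I) y → ⟦ S₁ ⟧NAA I ⊎ ⟦ S₂ ⟧NAA I)
          (λ s∈ r → inj₁ ((λ i s → R i (inj₁ s)) ,
                          NAAEmbedding.refinement-∘ʳ ∨NAA-inj₁ {LTS→NAA I} {R} ref ,
                          λ { (here refl) → _ , s∈ , r }))
          (λ s∈ r → inj₂ ((λ i s → R i (inj₂ s)) ,
                          NAAEmbedding.refinement-∘ʳ ∨NAA-inj₂ {LTS→NAA I} {R} ref ,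
                          λ { (here refl) → _ , s∈ , r }))
          x∈ r

  DMTSRefinesAt : (S₁ S₂ : DMTS A) → (DMTS.State S₁ → DMTS.State S₂ → Set) →
                  DMTS.State S₁ → DMTS.State S₂ → Set
  DMTSRefinesAt S₁ S₂ R s₁ s₂ =
      (∀ {a t₁} → (a , t₁) ∈ DMTS.may S₁ s₁ →
         ∃[ t₂ ] ((a , t₂) ∈ DMTS.may S₂ s₂ × R t₁ t₂))
    × (∀ {N₂} → DMTS.Must S₂ s₂ N₂ →
         ∃[ N₁ ] ( DMTS.Must S₁ s₁ N₁
                 × (∀ {a t₁} → (a , t₁) ∈ N₁ → ∃[ t₂ ] ((a , t₂) ∈ N₂ × R t₁ t₂))))

  record IsDMTSEmbedding (S T : DMTS A) (e : DMTS.State S → DMTS.State T) : Set where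
    field
      may-relabel : ∀ s → DMTS.may T (e s) ≡ relabel e (DMTS.may S s)
      must⁺ : ∀ {s N} → DMTS.Must S s N → DMTS.Must T (e s) (relabel e N)
      must⁻ : ∀ {s N} → DMTS.Must T (e s) N → ∃[ N' ] (DMTS.Must S s N' × N ≡ relabel e N')
      init⁺ : ∀ {s} → s ∈ DMTS.Init S → e s ∈ DMTS.Init T

  module DMTSEmbedding {S T : DMTS A} {e : DMTS.State S → DMTS.State T}
                       (emb : IsDMTSEmbedding S T e) where
    open IsDMTSEmbedding emb

    ∈-may⁺ : ∀ {s x} → x ∈ relabel e (DMTS.may S s) → x ∈ DMTS.may T (e s)
    ∈-may⁺ {s} = subst (_ ∈_) (sym (may-relabel s))

    ∈-may⁻ : ∀ {s x} → x ∈ DMTS.may T (e s) → x ∈ relabel e (DMTS.may S s)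
    ∈-may⁻ {s} = subst (_ ∈_) (may-relabel s)

    refinement-∘ˡ : ∀ {U R} → IsDMTSRefinement T U R → IsDMTSRefinement S U (λ s → R (e s))
    refinement-∘ˡ ref r =
      (λ x∈ → proj₁ (ref r) (∈-may⁺ (∈-relabel⁺ x∈))) ,
      λ m → let (N , mT , fwd) = proj₂ (ref r) m
                (N' , mS , N≡) = must⁻ mT
            in N' , mS , λ x∈ → fwd (subst (_ ∈_) (sym N≡) (∈-relabel⁺ x∈))

    refinesAt-image : ∀ {U R} → IsDMTSRefinement S U (λ s → R (e s)) →
                      ∀ {s u} → R (e s) u → DMTSRefinesAt T U R (e s) u
    refinesAt-image ref r =
      (λ x∈ → ∀-∈-relabel (proj₁ (ref r)) (∈-may⁻ x∈)) ,
      λ m → let (N , mS , fwd) = proj₂ (ref r) m in relabel e N , must⁺ mS , ∀-∈-relabel fwd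

    refinement-∘ʳ : ∀ {X R} → IsDMTSRefinement X T R → IsDMTSRefinement X S (λ x s → R x (e s))
    refinement-∘ʳ ref r =
      (λ x∈ → ∃-∈-relabel⁻ (map₂ (map₁ ∈-may⁻) (proj₁ (ref r) x∈))) ,
      λ m → let (N , mX , fwd) = proj₂ (ref r) (must⁺ m) in N , mX , λ x∈ → ∃-∈-relabel⁻ (fwd x∈)

    refinement-image : ∀ {X R} → IsDMTSRefinement X S R →
                       IsDMTSRefinement X T (λ x t → ∃[ s ] (e s ≡ t × R x s))
    refinement-image ref (s , refl , r) =
      (λ x∈ → map₂ (map₁ ∈-may⁺)
                (∃-∈-relabel⁺ (map₂ (map₂ λ r' → _ , refl , r') (proj₁ (ref r) x∈)))) ,
      λ m → let (N' , mS , N≡) = must⁻ m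
                (N , mX , fwd) = proj₂ (ref r) mS
            in N , mX , λ x∈ → subst (λ L → ∃[ t ] (_ ∈ L × _)) (sym N≡)
                                 (∃-∈-relabel⁺ (map₂ (map₂ λ r' → _ , refl , r') (fwd x∈)))

    ≤-∘ˡ : ∀ {U} → T ≤DMTS U → S ≤DMTS U
    ≤-∘ˡ {U} (R , ref , ini) = (λ s → R (e s)) , refinement-∘ˡ {U} ref , λ s∈ → ini (init⁺ s∈)

    ≤-image : ∀ {X} → X ≤DMTS S → X ≤DMTS T
    ≤-image {X} (R , ref , ini) = (λ x t → ∃[ s ] (e s ≡ t × R x s)) , refinement-image {X} ref ,
      λ x∈ → let (s , s∈ , r) = ini x∈ in e s , init⁺ s∈ , s , refl , r

  module _ {S₁ S₂ : DMTS A} where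

    ∨DMTS-inj₁ : IsDMTSEmbedding S₁ (S₁ ∨DMTS S₂) inj₁
    ∨DMTS-inj₁ = record
      { may-relabel = λ _ → refl
      ; must⁺ = λ m → _ , m , refl
      ; must⁻ = λ m → m
      ; init⁺ = λ s∈ → ∈-++⁺ˡ (∈-map⁺ inj₁ s∈)
      }

    ∨DMTS-inj₂ : IsDMTSEmbedding S₂ (S₁ ∨DMTS S₂) inj₂
    ∨DMTS-inj₂ = record
      { may-relabel = λ _ → refl
      ; must⁺ = λ m → _ , m , refl
      ; must⁻ = λ m → m
      ; init⁺ = λ s∈ → ∈-++⁺ʳ (map inj₁ (DMTS.Init S₁)) (∈-map⁺ inj₂ s∈)
      }

    ∨DMTS-refinement : ∀ {U R₁ R₂} → IsDMTSRefinement S₁ U R₁ → IsDMTSRefinement S₂ U R₂ →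
                       IsDMTSRefinement (S₁ ∨DMTS S₂) U [ R₁ , R₂ ]′
    ∨DMTS-refinement {U} {R₁} {R₂} ref₁ ref₂ {inj₁ s} =
      DMTSEmbedding.refinesAt-image ∨DMTS-inj₁ {U} {[ R₁ , R₂ ]′} ref₁
    ∨DMTS-refinement {U} {R₁} {R₂} ref₁ ref₂ {inj₂ s} =
      DMTSEmbedding.refinesAt-image ∨DMTS-inj₂ {U} {[ R₁ , R₂ ]′} ref₂

    ∨DMTS-lub : ∀ S₃ → (S₁ ∨DMTS S₂) ≤DMTS S₃ ⇔ (S₁ ≤DMTS S₃ × S₂ ≤DMTS S₃)
    ∨DMTS-lub S₃ = mk⇔
      (λ le → DMTSEmbedding.≤-∘ˡ ∨DMTS-inj₁ {S₃} le , DMTSEmbedding.≤-∘ˡ ∨DMTS-inj₂ {S₃} le)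
      (λ ((R₁ , ref₁ , ini₁) , (R₂ , ref₂ , ini₂)) →
        [ R₁ , R₂ ]′ , ∨DMTS-refinement {S₃} ref₁ ref₂ ,
        ∈-map-inj-++-elim (λ s → ∃[ s₃ ] (s₃ ∈ DMTS.Init S₃ × [ R₁ , R₂ ]′ s s₃)) ini₁ ini₂)

    ∨DMTS-denotation : ∀ I → ⟦ S₁ ∨DMTS S₂ ⟧DMTS I ⇔ (⟦ S₁ ⟧DMTS I ⊎ ⟦ S₂ ⟧DMTS I)
    ∨DMTS-denotation I =
      mk⇔ to [ DMTSEmbedding.≤-image ∨DMTS-inj₁ {LTS→DMTS I}
             , DMTSEmbedding.≤-image ∨DMTS-inj₂ {LTS→DMTS I} ]′
      where
      to : ⟦ S₁ ∨DMTS S₂ ⟧DMTS I → ⟦ S₁ ⟧DMTS I ⊎ ⟦ S₂ ⟧DMTS I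
      to (R , ref , ini) with ini (here refl)
      ... | x , x∈ , r =
        ∈-map-inj-++-elim (λ y → R (LTS.init I) y → ⟦ S₁ ⟧DMTS I ⊎ ⟦ S₂ ⟧DMTS I)
          (λ s∈ r → inj₁ ((λ i s → R i (inj₁ s)) ,
                          DMTSEmbedding.refinement-∘ʳ ∨DMTS-inj₁ {LTS→DMTS I} {R} ref ,
                          λ { (here refl) → _ , s∈ , r }))
          (λ s∈ r → inj₂ ((λ i s → R i (inj₂ s)) ,
                          DMTSEmbedding.refinement-∘ʳ ∨DMTS-inj₂ {LTS→DMTS I} {R} ref ,
                          λ { (here refl) → _ , s∈ , r }))
          x∈ r

theorem2 : (k : ℕ) →
    ((S₁ S₂ S₃ : NAA (Fin k)) →
    ((I : LTS (Fin k)) → ⟦ S₁ ∨NAA S₂ ⟧NAA I ⇔ (⟦ S₁ ⟧NAA I ⊎ ⟦ S₂ ⟧NAA I))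
    × (((S₁ ∨NAA S₂) ≤NAA S₃) ⇔ ((S₁ ≤NAA S₃) × (S₂ ≤NAA S₃))))
    × ((S₁ S₂ S₃ : DMTS (Fin k)) →
    ((I : LTS (Fin k)) → ⟦ S₁ ∨DMTS S₂ ⟧DMTS I ⇔ (⟦ S₁ ⟧DMTS I ⊎ ⟦ S₂ ⟧DMTS I))
    × (((S₁ ∨DMTS S₂) ≤DMTS S₃) ⇔ ((S₁ ≤DMTS S₃) × (S₂ ≤DMTS S₃))))
theorem2 k = (λ S₁ S₂ S₃ → ∨NAA-denotation , ∨NAA-lub S₃)
           , (λ S₁ S₂ S₃ → ∨DMTS-denotation , ∨DMTS-lub S₃)
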